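{- Let $p\equiv 1\pmod 4$ be a prime and $g$ any primitive root of $p$. Then $$\prod_{\substack{r,s=1\\ r\ne s}}^{(p-1)/4}(g^{4r}-g^{4s})\equiv -\left(\frac{2}{p}\right)\pmod p,$$ where $\left(\frac{2}{p}\right)$ is the Legendre symbol. -}

module Defs where

open import Data.Nat as ℕ using (ℕ; zero; suc)
open import Data.Integer as ℤ using (ℤ; +_; -_; _-_; _*_; _^_)
open import Data.Integer.Divisibility using (_∣_)
open import Data.List using (List; []; _∷_; foldr; upTo; map; concatMap; filter)
open import Data.Product using (∃; _×_; _,_)
open import Relation.Nullary using (¬_; ¬?)
open import Relation.Binary.PropositionalEquality using (_≡_)

_≡_[mod_] : ℤ → ℤ → ℕ → Set
a ≡ b [mod m ] = (+ m) ∣ (a - b)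

productℤ : List ℤ → ℤ
productℤ = foldr _*_ (+ 1)

oneTo : ℕ → List ℕ
oneTo n = map suc (upTo n)

IsPrimitiveRoot : ℤ → ℕ → Set
IsPrimitiveRoot g p =
  ¬ (g ≡ + 0 [mod p ]) ×
  ((g ^ (p ℕ.∸ 1)) ≡ + 1 [mod p ]) ×
  (∀ (k : ℕ) → 1 ℕ.≤ k → k ℕ.< p ℕ.∸ 1 → ¬ ((g ^ k) ≡ + 1 [mod p ]))

IsQR : ℤ → ℕ → Set
IsQR a p = ∃ λ (x : ℤ) → (x * x) ≡ a [mod p ]

-- The value of the Legendre symbol (a/p) for an odd prime p and p ∤ a
-- (the only case used here, a = 2): relation "Legendre a p v" holds when
-- v = +1 if a is a quadratic residue mod p and v = -1 otherwise.
data Legendre (a : ℤ) (p : ℕ) : ℤ → Set where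
  qr    : IsQR a p → Legendre a p (+ 1)
  nonqr : ¬ IsQR a p → Legendre a p (- (+ 1))

doubleProd : ℤ → ℕ → ℤ
doubleProd g n =
  productℤ (concatMap (λ r → map (λ s → (g ^ (4 ℕ.* r)) - (g ^ (4 ℕ.* s)))
                                 (filter (λ s → ¬? (r ℕ.≟ s)) (oneTo n)))
                      (oneTo n))

{-# OPTIONS --safe #-}

-- With n = (p − 1)/4 and ζᵣ = g^(4r), the ζᵣ (1 ≤ r ≤ n) are n distinct roots of xⁿ − 1
-- modulo p, so xⁿ − 1 ≡ ∏ᵣ (x − ζᵣ). Dividing out x − ζᵣ and evaluating at ζᵣ gives
-- ∏_{s≠r} (ζᵣ − ζₛ) ≡ n ζᵣⁿ⁻¹, while evaluating at 0 gives ∏ᵣ (−ζᵣ) ≡ −1. Hence the double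
-- product D satisfies 4ⁿ · D · ∏ᵣ (−ζᵣ) ≡ ∏ᵣ (−4n ζᵣⁿ) ≡ 1, as 4n ≡ −1 and ζᵣⁿ ≡ 1, that is
-- 4ⁿ D ≡ −1. Finally 4ⁿ = 2^((p−1)/2) ≡ (2/p) by Euler's criterion, proved through the
-- discrete logarithm to base g.

module Submission where

open import Defs

open import Data.Empty using (⊥-elim)
open import Data.Fin as Fin using (Fin; zero; suc; toℕ; fromℕ<)
open import Data.Fin.Properties using (toℕ-fromℕ<; toℕ<n; pigeonhole)
open import Data.Integer using (ℤ; +_; -_; ∣_∣; _+_; _-_; _*_; _^_; 0ℤ; 1ℤ; -1ℤ)
open import Data.Integer.Divisibility.Signed
  using (_∣_; divides; ∣ᵤ⇒∣; ∣⇒∣ᵤ; ∣m⇒∣-m; ∣m∣n⇒∣m+n; ∣m⇒∣m*n; ∣n⇒∣m*n)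
open import Data.Integer.DivMod using (_%ℕ_; _/ℕ_; n%ℕd<d; a≡a%ℕn+[a/ℕn]*n)
open import Data.Integer.Properties
  using ( abs-*; pos-+; +-identityʳ; +-inverseʳ; *-identityˡ; *-identityʳ; *-assoc; *-zeroʳ
        ; ^-zeroˡ; ^-*-assoc; ^-distribˡ-+-*)
open import Data.Integer.Tactic.RingSolver using (solve-∀)
open import Data.List using (List; []; _∷_; _++_; map; concatMap; filter; length; last; upTo)
open import Data.List.Membership.Propositional using (_∈_)
open import Data.List.Membership.Propositional.Properties using (∈-map⁻; ∈-upTo⁻; ∈-filter⁻)
open import Data.List.Properties
  using (length-map; length-upTo; map-∘; filter-accept; filter-reject; filter-all)
open import Data.List.Relation.Unary.All as All using (All; []; _∷_)
import Data.List.Relation.Unary.All.Properties as Allₚ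
open import Data.List.Relation.Unary.AllPairs using (AllPairs; []; _∷_)
import Data.List.Relation.Unary.AllPairs.Properties as AllPairs
open import Data.List.Relation.Unary.Any using (here; there)
open import Data.List.Relation.Unary.Unique.Propositional using (Unique)
import Data.List.Relation.Unary.Unique.Propositional.Properties as Unique
open import Data.Maybe using (just)
open import Data.Nat as ℕ using (ℕ; zero; suc; _%_; _/_; _∸_; _<_; z≤n; s≤s; NonZero)
open import Data.Nat.Divisibility using (∣1⇒≡1; ∣⇒≤) renaming (_∣_ to _ℕ∣_)
open import Data.Nat.DivMod using (m≡m%n+[m/n]*n; m*n/n≡m)
open import Data.Nat.Primality using (Prime; euclidsLemma; ¬prime[1]; prime⇒nonZero)
import Data.Nat.Properties as ℕ
import Data.Nat.Tactic.RingSolver as NatSolver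
open import Data.Product using (_×_; _,_; map₁; proj₁; proj₂; ∃; ∃₂)
open import Data.Sum as Sum using (_⊎_; inj₁; inj₂; [_,_]′)
open import Function using (_∘_; id)
open import Level using (0ℓ)
open import Relation.Binary.Bundles using (Setoid)
open import Relation.Binary.Definitions using (tri<; tri≈; tri>)
open import Relation.Binary.PropositionalEquality
  using (_≡_; _≢_; refl; sym; trans; cong; cong₂; subst; module ≡-Reasoning)
import Relation.Binary.Reasoning.Setoid as SetoidReasoning
open import Relation.Nullary using (¬_; ¬?)

productℤ-++ : ∀ xs ys → productℤ (xs ++ ys) ≡ productℤ xs * productℤ ys
productℤ-++ []       ys = sym (*-identityˡ _)
productℤ-++ (x ∷ xs) ys = trans (cong (x *_) (productℤ-++ xs ys)) (sym (*-assoc x _ _))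

productℤ-concatMap : ∀ {A : Set} (f : A → List ℤ) xs →
  productℤ (concatMap f xs) ≡ productℤ (map (λ x → productℤ (f x)) xs)
productℤ-concatMap f []       = refl
productℤ-concatMap f (x ∷ xs) =
  trans (productℤ-++ (f x) (concatMap f xs)) (cong (productℤ (f x) *_) (productℤ-concatMap f xs))

productℤ-map-* : ∀ {A : Set} (f h : A → ℤ) xs →
  productℤ (map (λ x → f x * h x) xs) ≡ productℤ (map f xs) * productℤ (map h xs)
productℤ-map-* f h []       = refl
productℤ-map-* f h (x ∷ xs) =
  trans (cong (f x * h x *_) (productℤ-map-* f h xs)) (interchange (f x) (h x) _ _)
  where
  interchange : ∀ a b c d → (a * b) * (c * d) ≡ (a * c) * (b * d)
  interchange = solve-∀

productℤ-map-const : ∀ {A : Set} c (xs : List A) → productℤ (map (λ _ → c) xs) ≡ c ^ length xs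
productℤ-map-const c []       = refl
productℤ-map-const c (x ∷ xs) = cong (c *_) (productℤ-map-const c xs)

-- Polynomials are coefficient lists, constant term first.

eval : List ℤ → ℤ → ℤ
eval []       x = 0ℤ
eval (c ∷ cs) x = c + x * eval cs x

Monic : ℕ → List ℤ → Set
Monic d cs = length cs ≡ suc d × last cs ≡ just 1ℤ

quotient : ℤ → List ℤ → List ℤ
quotient a []            = []
quotient a (c ∷ [])      = []
quotient a (c ∷ c′ ∷ cs) = eval (c′ ∷ cs) a ∷ quotient a (c′ ∷ cs)

eval-quotient : ∀ a cs x → eval cs x ≡ (x - a) * eval (quotient a cs) x + eval cs a
eval-quotient a []            x = sym (trans (+-identityʳ _) (*-zeroʳ (x - a)))
eval-quotient a (c ∷ [])      x = constant a c x
  where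
  constant : ∀ a c x → c + x * 0ℤ ≡ (x - a) * 0ℤ + (c + a * 0ℤ)
  constant = solve-∀
eval-quotient a (c ∷ c′ ∷ cs) x =
  trans (cong (λ e → c + x * e) (eval-quotient a (c′ ∷ cs) x))
        (horner c x a (eval (c′ ∷ cs) a) (eval (quotient a (c′ ∷ cs)) x))
  where
  horner : ∀ c x a r q → c + x * ((x - a) * q + r) ≡ (x - a) * (r + x * q) + (c + a * r)
  horner = solve-∀

quotient-monic : ∀ {d} a cs → Monic (suc d) cs → Monic d (quotient a cs)
quotient-monic a (c ∷ c′ ∷ [])             (refl , refl)   = refl , cong (λ e → just (1ℤ + e)) (*-zeroʳ a)
quotient-monic {suc d} a (c ∷ c′ ∷ c″ ∷ cs) (degree , leading) =
  map₁ (cong suc) (quotient-monic a (c′ ∷ c″ ∷ cs) (ℕ.suc-injective degree , leading))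

geometric : ℤ → ℕ → List ℤ
geometric a zero    = []
geometric a (suc k) = a ^ k ∷ geometric a k

geometric-monic : ∀ a k → Monic k (geometric a (suc k))
geometric-monic a zero    = refl , refl
geometric-monic a (suc k) = map₁ (cong suc) (geometric-monic a k)

eval-geometric : ∀ a x k → (x - a) * eval (geometric a k) x ≡ x ^ k - a ^ k
eval-geometric a x zero    = *-zeroʳ (x - a)
eval-geometric a x (suc k) = begin
  (x - a) * (a ^ k + x * q)               ≡⟨ shift x a (a ^ k) q ⟩
  (x - a) * a ^ k + x * ((x - a) * q)     ≡⟨ cong (λ e → (x - a) * a ^ k + x * e) (eval-geometric a x k) ⟩
  (x - a) * a ^ k + x * (x ^ k - a ^ k)   ≡⟨ telescope x a (a ^ k) (x ^ k) ⟩
  x * x ^ k - a * a ^ k                   ∎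
  where
  open ≡-Reasoning
  q : ℤ
  q = eval (geometric a k) x
  shift : ∀ x a b e → (x - a) * (b + x * e) ≡ (x - a) * b + x * ((x - a) * e)
  shift = solve-∀
  telescope : ∀ x a b y → (x - a) * b + x * (y - b) ≡ x * y - a * b
  telescope = solve-∀

eval-geometric-at : ∀ a k → eval (geometric a (suc k)) a ≡ + suc k * a ^ k
eval-geometric-at a zero    = cong (λ e → 1ℤ + e) (*-zeroʳ a)
eval-geometric-at a (suc k) = begin
  a * a ^ k + a * eval (geometric a (suc k)) a   ≡⟨ cong (λ e → a * a ^ k + a * e) (eval-geometric-at a k) ⟩
  a * a ^ k + a * (+ suc k * a ^ k)              ≡⟨ collect a (a ^ k) (+ suc k) ⟩
  (1ℤ + + suc k) * (a * a ^ k)                   ≡⟨ cong (_* (a * a ^ k)) (pos-+ 1 (suc k)) ⟨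
  + suc (suc k) * a ^ suc k                      ∎
  where
  open ≡-Reasoning
  collect : ∀ a b m → a * b + a * (m * b) ≡ (1ℤ + m) * (a * b)
  collect = solve-∀

-- geometric 0ℤ n is x^(n-1), so -1 + x * x^(n-1) = x^n - 1.
xⁿ-1 : ℕ → List ℤ
xⁿ-1 n = -1ℤ ∷ geometric 0ℤ n

xⁿ-1-monic : ∀ k → Monic (suc k) (xⁿ-1 (suc k))
xⁿ-1-monic k = map₁ (cong suc) (geometric-monic 0ℤ k)

eval-xⁿ-1 : ∀ n x → eval (xⁿ-1 (suc n)) x ≡ x ^ suc n - 1ℤ
eval-xⁿ-1 n x = begin
  -1ℤ + x * q                 ≡⟨ cong (λ y → -1ℤ + y * q) (+-identityʳ x) ⟨
  -1ℤ + (x - 0ℤ) * q          ≡⟨ cong (λ y → -1ℤ + y) (eval-geometric 0ℤ x (suc n)) ⟩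
  -1ℤ + (x ^ suc n - 0ℤ)      ≡⟨ reorder (x ^ suc n) ⟩
  x ^ suc n - 1ℤ              ∎
  where
  open ≡-Reasoning
  q : ℤ
  q = eval (geometric 0ℤ (suc n)) x
  reorder : ∀ y → -1ℤ + (y - 0ℤ) ≡ y - 1ℤ
  reorder = solve-∀

length-oneTo : ∀ n → length (oneTo n) ≡ n
length-oneTo n = trans (length-map suc (upTo n)) (length-upTo n)

oneTo-unique : ∀ n → Unique (oneTo n)
oneTo-unique n = Unique.map⁺ ℕ.suc-injective (Unique.upTo⁺ n)

∈-oneTo⁻ : ∀ {n r} → r ∈ oneTo n → ∃ λ i → i < n × r ≡ suc i
∈-oneTo⁻ r∈ with i , i∈ , refl ← ∈-map⁻ suc r∈ = i , ∈-upTo⁻ i∈ , refl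

length-filter-≢ : ∀ {r xs} → Unique xs → r ∈ xs →
                  length (filter (λ s → ¬? (r ℕ.≟ s)) xs) ≡ ℕ.pred (length xs)
length-filter-≢ {r} (r∉xs ∷ _) (here refl) =
  cong length (trans (filter-reject (λ s → ¬? (r ℕ.≟ s)) (λ r≢r → r≢r refl))
                     (filter-all (λ s → ¬? (r ℕ.≟ s)) r∉xs))
length-filter-≢ {r} {x ∷ _ ∷ _} (x∉xs ∷ unique) (there r∈xs) =
  trans (cong length (filter-accept (λ s → ¬? (r ℕ.≟ s)) (λ r≡x → All.lookup x∉xs r∈xs (sym r≡x))))
        (cong suc (length-filter-≢ unique r∈xs))

module Congruence (m : ℕ) where

  -- A record rather than a function, so that a and b can be inferred from a proof of a ≈ b.
  infix 4 _≈_ _≉_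
  record _≈_ (a b : ℤ) : Set where
    constructor mod
    field divides-difference : + m ∣ a - b

  _≉_ : ℤ → ℤ → Set
  a ≉ b = ¬ a ≈ b

  private
    by : ∀ {x y} → x ≡ y → + m ∣ x → + m ∣ y
    by = subst (+ m ∣_)

  ≈-reflexive : ∀ {a b} → a ≡ b → a ≈ b
  ≈-reflexive {a} refl = mod (divides 0ℤ (+-inverseʳ a))

  ≈-refl : ∀ {a} → a ≈ a
  ≈-refl = ≈-reflexive refl

  ≈-sym : ∀ {a b} → a ≈ b → b ≈ a
  ≈-sym {a} {b} (mod d) = mod (by (negate a b) (∣m⇒∣-m d))
    where
    negate : ∀ a b → - (a - b) ≡ b - a
    negate = solve-∀

  ≈-trans : ∀ {a b c} → a ≈ b → b ≈ c → a ≈ c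
  ≈-trans {a} {b} {c} (mod d) (mod e) = mod (by (chain a b c) (∣m∣n⇒∣m+n d e))
    where
    chain : ∀ a b c → (a - b) + (b - c) ≡ a - c
    chain = solve-∀

  ≈-setoid : Setoid 0ℓ 0ℓ
  ≈-setoid = record
    { _≈_ = _≈_
    ; isEquivalence = record { refl = ≈-refl ; sym = ≈-sym ; trans = ≈-trans }
    }

  module ≈-Reasoning = SetoidReasoning ≈-setoid

  +-cong : ∀ {a b c d} → a ≈ b → c ≈ d → a + c ≈ b + d
  +-cong {a} {b} {c} {d} (mod x) (mod y) = mod (by (split a b c d) (∣m∣n⇒∣m+n x y))
    where
    split : ∀ a b c d → (a - b) + (c - d) ≡ (a + c) - (b + d)
    split = solve-∀

  *-cong : ∀ {a b c d} → a ≈ b → c ≈ d → a * c ≈ b * d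
  *-cong {a} {b} {c} {d} (mod x) (mod y) =
    mod (by (split a b c d) (∣m∣n⇒∣m+n (∣m⇒∣m*n c x) (∣n⇒∣m*n b y)))
    where
    split : ∀ a b c d → (a - b) * c + b * (c - d) ≡ a * c - b * d
    split = solve-∀

  +-congˡ : ∀ a {b c} → b ≈ c → a + b ≈ a + c
  +-congˡ a = +-cong (≈-refl {a})

  +-congʳ : ∀ a {b c} → b ≈ c → b + a ≈ c + a
  +-congʳ a b≈c = +-cong b≈c (≈-refl {a})

  *-congˡ : ∀ a {b c} → b ≈ c → a * b ≈ a * c
  *-congˡ a = *-cong (≈-refl {a})

  *-congʳ : ∀ a {b c} → b ≈ c → b * a ≈ c * a
  *-congʳ a b≈c = *-cong b≈c (≈-refl {a})

  -‿cong : ∀ {a b} → a ≈ b → - a ≈ - b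
  -‿cong {a} {b} (mod x) = mod (by (negate a b) (∣m⇒∣-m x))
    where
    negate : ∀ a b → - (a - b) ≡ - a - - b
    negate = solve-∀

  ^-congˡ : ∀ {a b} n → a ≈ b → a ^ n ≈ b ^ n
  ^-congˡ zero    a≈b = ≈-refl
  ^-congˡ (suc n) a≈b = *-cong a≈b (^-congˡ n a≈b)

  ∣⇒≈0 : ∀ {a} → + m ∣ a → a ≈ 0ℤ
  ∣⇒≈0 {a} d = mod (by (sym (+-identityʳ a)) d)

  ≈0⇒∣ : ∀ {a} → a ≈ 0ℤ → + m ∣ a
  ≈0⇒∣ {a} (mod d) = by (+-identityʳ a) d

  -≈0⇒≈ : ∀ {a b} → a - b ≈ 0ℤ → a ≈ b
  -≈0⇒≈ = mod ∘ ≈0⇒∣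

  +a≉0 : ∀ {a} → 0 < a → a < m → + a ≉ 0ℤ
  +a≉0 {a} 0<a a<m a≈0 = ℕ.<⇒≱ a<m (∣⇒≤ {{ℕ.>-nonZero 0<a}} (∣⇒∣ᵤ (≈0⇒∣ a≈0)))

  ≡[mod]⇒≈ : ∀ {a b} → a ≡ b [mod m ] → a ≈ b
  ≡[mod]⇒≈ d = mod (∣ᵤ⇒∣ d)

  ≈⇒≡[mod] : ∀ {a b} → a ≈ b → a ≡ b [mod m ]
  ≈⇒≡[mod] (mod d) = ∣⇒∣ᵤ d

  productℤ-cong : ∀ {A : Set} {f h : A → ℤ} xs → All (λ x → f x ≈ h x) xs →
                  productℤ (map f xs) ≈ productℤ (map h xs)
  productℤ-cong []       []         = ≈-refl
  productℤ-cong (x ∷ xs) (fx≈hx ∷ rest) = *-cong fx≈hx (productℤ-cong xs rest)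

module ModPrime {p : ℕ} (p-prime : Prime p) where

  open Congruence p
  open ≈-Reasoning

  *≈0⇒≈0⊎≈0 : ∀ {a b} → a * b ≈ 0ℤ → a ≈ 0ℤ ⊎ b ≈ 0ℤ
  *≈0⇒≈0⊎≈0 {a} {b} ab≈0 =
    Sum.map (∣⇒≈0 ∘ ∣ᵤ⇒∣) (∣⇒≈0 ∘ ∣ᵤ⇒∣)
      (euclidsLemma ∣ a ∣ ∣ b ∣ p-prime (subst (p ℕ∣_) (abs-* a b) (∣⇒∣ᵤ (≈0⇒∣ ab≈0))))

  *≈0⇒≈0 : ∀ {a b} → a ≉ 0ℤ → a * b ≈ 0ℤ → b ≈ 0ℤ
  *≈0⇒≈0 a≉0 = [ ⊥-elim ∘ a≉0 , id ]′ ∘ *≈0⇒≈0⊎≈0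

  *-cancelˡ-≈ : ∀ {c a b} → c ≉ 0ℤ → c * a ≈ c * b → a ≈ b
  *-cancelˡ-≈ {c} {a} {b} c≉0 ca≈cb = -≈0⇒≈ (*≈0⇒≈0 c≉0 (begin
    c * (a - b)    ≡⟨ factor c a b ⟩
    c * a - c * b  ≈⟨ +-congʳ (- (c * b)) ca≈cb ⟩
    c * b - c * b  ≡⟨ +-inverseʳ (c * b) ⟩
    0ℤ             ∎))
    where
    factor : ∀ c a b → c * (a - b) ≡ c * a - c * b
    factor = solve-∀

  1≉0 : 1ℤ ≉ 0ℤ
  1≉0 1≈0 = ¬prime[1] (subst Prime (∣1⇒≡1 (∣⇒∣ᵤ (≈0⇒∣ 1≈0))) p-prime)

  ^-≉0 : ∀ {a} → a ≉ 0ℤ → ∀ n → a ^ n ≉ 0ℤ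
  ^-≉0 a≉0 zero    = 1≉0
  ^-≉0 a≉0 (suc n) = [ a≉0 , ^-≉0 a≉0 n ]′ ∘ *≈0⇒≈0⊎≈0

  x²≈1⇒x≈±1 : ∀ {x} → x * x ≈ 1ℤ → x ≈ 1ℤ ⊎ x ≈ -1ℤ
  x²≈1⇒x≈±1 {x} x²≈1 = Sum.map -≈0⇒≈ (-≈0⇒≈ ∘ ≈-trans (≈-reflexive (x--1≡x+1 x))) (*≈0⇒≈0⊎≈0 (begin
    (x - 1ℤ) * (x + 1ℤ) ≡⟨ difference-of-squares x ⟩
    x * x - 1ℤ          ≈⟨ +-congʳ -1ℤ x²≈1 ⟩
    1ℤ - 1ℤ             ∎))
    where
    difference-of-squares : ∀ x → (x - 1ℤ) * (x + 1ℤ) ≡ x * x - 1ℤ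
    difference-of-squares = solve-∀
    x--1≡x+1 : ∀ x → x - -1ℤ ≡ x + 1ℤ
    x--1≡x+1 = solve-∀

  quotient-root : ∀ {a b} cs → b ≉ a → eval cs a ≈ 0ℤ → eval cs b ≈ 0ℤ →
                  eval (quotient a cs) b ≈ 0ℤ
  quotient-root {a} {b} cs b≉a a-root b-root = *≈0⇒≈0 (b≉a ∘ -≈0⇒≈) (begin
    (b - a) * q               ≡⟨ +-identityʳ _ ⟨
    (b - a) * q + 0ℤ          ≈⟨ +-congˡ ((b - a) * q) a-root ⟨
    (b - a) * q + eval cs a   ≡⟨ eval-quotient a cs b ⟨
    eval cs b                 ≈⟨ b-root ⟩
    0ℤ                        ∎)
    where
    q : ℤ
    q = eval (quotient a cs) b

  monic-factorisation : ∀ as cs → Monic (length as) cs → AllPairs _≉_ as →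
                        All (λ a → eval cs a ≈ 0ℤ) as →
                        ∀ x → eval cs x ≈ productℤ (map (λ a → x - a) as)
  monic-factorisation []       (c ∷ []) (refl , refl) [] [] x =
    ≈-reflexive (cong (λ e → 1ℤ + e) (*-zeroʳ x))
  monic-factorisation (a ∷ as) cs monic (a∉as ∷ distinct) (a-root ∷ roots) x = begin
    eval cs x                                                  ≡⟨ eval-quotient a cs x ⟩
    (x - a) * eval (quotient a cs) x + eval cs a               ≈⟨ +-cong (*-congˡ (x - a) factors) a-root ⟩
    (x - a) * productℤ (map (λ b → x - b) as) + 0ℤ             ≡⟨ +-identityʳ _ ⟩
    productℤ (map (λ b → x - b) (a ∷ as))                      ∎
    where
    factors : eval (quotient a cs) x ≈ productℤ (map (λ b → x - b) as)
    factors = monic-factorisation as (quotient a cs) (quotient-monic a cs monic) distinct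
                (All.zipWith (λ (b≉a , b-root) → quotient-root cs b≉a a-root b-root)
                  (All.map (_∘ ≈-sym) a∉as , roots))
                x

  eval-geometric-root : ∀ {a b} n → b ≉ a → b ^ n ≈ a ^ n → eval (geometric a n) b ≈ 0ℤ
  eval-geometric-root {a} {b} n b≉a bⁿ≈aⁿ = *≈0⇒≈0 (b≉a ∘ -≈0⇒≈) (begin
    (b - a) * eval (geometric a n) b   ≡⟨ eval-geometric a b n ⟩
    b ^ n - a ^ n                      ≈⟨ +-congʳ (- a ^ n) bⁿ≈aⁿ ⟩
    a ^ n - a ^ n                      ≡⟨ +-inverseʳ (a ^ n) ⟩
    0ℤ                                 ∎)

  private instance
    p-nonZero : NonZero p
    p-nonZero = prime⇒nonZero p-prime

  residue : ℤ → Fin p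
  residue a = fromℕ< (n%ℕd<d a p)

  residue-injective : ∀ {a b} → residue a ≡ residue b → a ≈ b
  residue-injective {a} {b} same = mod (divides (a /ℕ p - b /ℕ p)
    (trans (cong₂ _-_ (a≡a%ℕn+[a/ℕn]*n a p)
                      (trans (a≡a%ℕn+[a/ℕn]*n b p) (cong (λ r → + r + b /ℕ p * + p) (sym same-remainder))))
           (cancel (+ (a %ℕ p)) (a /ℕ p) (b /ℕ p) (+ p))))
    where
    same-remainder : a %ℕ p ≡ b %ℕ p
    same-remainder = trans (sym (toℕ-fromℕ< _)) (trans (cong toℕ same) (toℕ-fromℕ< _))
    cancel : ∀ r q q′ d → (r + q * d) - (r + q′ * d) ≡ (q - q′) * d
    cancel = solve-∀

even⊎odd : ∀ i → (∃ λ j → i ≡ j ℕ.+ j) ⊎ (∃ λ j → i ≡ suc (j ℕ.+ j))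
even⊎odd zero = inj₁ (0 , refl)
even⊎odd (suc i) with even⊎odd i
... | inj₁ (j , refl) = inj₂ (j , refl)
... | inj₂ (j , refl) = inj₁ (suc j , cong suc (sym (ℕ.+-suc j j)))

Legendre⇒v*v≡1 : ∀ {a p v} → Legendre a p v → v * v ≡ 1ℤ
Legendre⇒v*v≡1 (qr _)    = refl
Legendre⇒v*v≡1 (nonqr _) = refl

module PrimitiveRoot {m : ℕ} (p-prime : Prime (suc m))
                     {g : ℤ} (g-primitive : IsPrimitiveRoot g (suc m)) where

  open Congruence (suc m)
  open ModPrime p-prime
  open ≈-Reasoning

  g≉0 : g ≉ 0ℤ
  g≉0 = proj₁ g-primitive ∘ ≈⇒≡[mod]

  gᵐ≈1 : g ^ m ≈ 1ℤ
  gᵐ≈1 = ≡[mod]⇒≈ (proj₁ (proj₂ g-primitive))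

  gⁱ≉1 : ∀ {i} → 0 < i → i < m → g ^ i ≉ 1ℤ
  gⁱ≉1 0<i i<m = proj₂ (proj₂ g-primitive) _ 0<i i<m ∘ ≈⇒≡[mod]

  g^[m*i]≈1 : ∀ i → g ^ (m ℕ.* i) ≈ 1ℤ
  g^[m*i]≈1 i = begin
    g ^ (m ℕ.* i) ≡⟨ ^-*-assoc g m i ⟨
    (g ^ m) ^ i   ≈⟨ ^-congˡ i gᵐ≈1 ⟩
    1ℤ ^ i        ≡⟨ ^-zeroˡ i ⟩
    1ℤ            ∎

  gⁱ≉gʲ : ∀ {i j} → i < j → j < i ℕ.+ m → g ^ i ≉ g ^ j
  gⁱ≉gʲ {i} {j} i<j j<i+m gⁱ≈gʲ = gⁱ≉1 (ℕ.m<n⇒0<n∸m i<j) j∸i<m (≈-sym (*-cancelˡ-≈ (^-≉0 g≉0 i) (begin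
    g ^ i * 1ℤ              ≡⟨ *-identityʳ (g ^ i) ⟩
    g ^ i                   ≈⟨ gⁱ≈gʲ ⟩
    g ^ j                   ≡⟨ cong (g ^_) (ℕ.m+[n∸m]≡n (ℕ.<⇒≤ i<j)) ⟨
    g ^ (i ℕ.+ (j ∸ i))     ≡⟨ ^-distribˡ-+-* g i (j ∸ i) ⟩
    g ^ i * g ^ (j ∸ i)     ∎)))
    where
    j∸i<m : j ∸ i < m
    j∸i<m = subst (j ∸ i <_) (ℕ.m+n∸m≡n i m) (ℕ.∸-monoˡ-< j<i+m (ℕ.<⇒≤ i<j))

  power-of-log : ∀ {a} e h → a ≈ g ^ e → a ^ h ≈ g ^ (e ℕ.* h)
  power-of-log e h a≈gᵉ = ≈-trans (^-congˡ h a≈gᵉ) (≈-reflexive (^-*-assoc g e h))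

  -- By pigeonhole two of the m + 2 numbers 0, a, g⁰, …, gᵐ⁻¹ are congruent modulo m + 1,
  -- and the order of g leaves only a ≡ gⁱ possible.
  discreteLog : ∀ {a} → a ≉ 0ℤ → ∃ λ i → a ≈ g ^ i
  discreteLog {a} a≉0 = collision (pigeonhole (ℕ.n<1+n (suc m)) (residue ∘ candidate))
    where
    candidate : Fin (suc (suc m)) → ℤ
    candidate zero          = 0ℤ
    candidate (suc zero)    = a
    candidate (suc (suc i)) = g ^ toℕ i

    collision : (∃₂ λ i j → i Fin.< j × residue (candidate i) ≡ residue (candidate j)) → ∃ λ i → a ≈ g ^ i
    collision (zero , suc zero , _ , same) = ⊥-elim (a≉0 (≈-sym (residue-injective same)))
    collision (zero , suc (suc j) , _ , same) = ⊥-elim (^-≉0 g≉0 (toℕ j) (≈-sym (residue-injective same)))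
    collision (suc zero , suc (suc j) , _ , same) = toℕ j , residue-injective same
    collision (suc zero , suc zero , s≤s () , _)
    collision (suc (suc i) , suc (suc j) , s≤s (s≤s i<j) , same) =
      ⊥-elim (gⁱ≉gʲ i<j (ℕ.<-≤-trans (toℕ<n j) (ℕ.m≤n+m m (toℕ i))) (residue-injective same))

  module _ (h : ℕ) (m≡h+h : m ≡ h ℕ.+ h) where

    g^[[h+h]*i]≈1 : ∀ i → g ^ ((h ℕ.+ h) ℕ.* i) ≈ 1ℤ
    g^[[h+h]*i]≈1 i = subst (λ e → g ^ (e ℕ.* i) ≈ 1ℤ) m≡h+h (g^[m*i]≈1 i)

    gʰ≈-1 : g ^ h ≈ -1ℤ
    gʰ≈-1 = [ ⊥-elim ∘ gⁱ≉1 0<h h<m , id ]′ (x²≈1⇒x≈±1 (begin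
      g ^ h * g ^ h  ≡⟨ ^-distribˡ-+-* g h h ⟨
      g ^ (h ℕ.+ h)  ≡⟨ cong (g ^_) m≡h+h ⟨
      g ^ m          ≈⟨ gᵐ≈1 ⟩
      1ℤ             ∎))
      where
      0<h : 0 < h
      0<h = ℕ.n≢0⇒n>0 λ h≡0 → ¬prime[1] (subst (Prime ∘ suc) (trans m≡h+h (cong₂ ℕ._+_ h≡0 h≡0)) p-prime)
      h<m : h < m
      h<m = subst (h <_) (sym m≡h+h) (ℕ.m<m+n h 0<h)

    qr^h≈1 : ∀ {a} → a ≉ 0ℤ → IsQR a (suc m) → a ^ h ≈ 1ℤ
    qr^h≈1 {a} a≉0 (x , x²≡a) with discreteLog x≉0
      where
      x≉0 : x ≉ 0ℤ
      x≉0 x≈0 = a≉0 (≈-trans (≈-sym (≡[mod]⇒≈ x²≡a)) (*-congʳ x x≈0))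
    ... | i , x≈gⁱ = begin
      a ^ h                    ≈⟨ power-of-log (i ℕ.+ i) h (begin
                                    a              ≈⟨ ≡[mod]⇒≈ x²≡a ⟨
                                    x * x          ≈⟨ *-cong x≈gⁱ x≈gⁱ ⟩
                                    g ^ i * g ^ i  ≡⟨ ^-distribˡ-+-* g i i ⟨
                                    g ^ (i ℕ.+ i)  ∎) ⟩
      g ^ ((i ℕ.+ i) ℕ.* h)   ≡⟨ cong (g ^_) (swap i h) ⟩
      g ^ ((h ℕ.+ h) ℕ.* i)   ≈⟨ g^[[h+h]*i]≈1 i ⟩
      1ℤ                       ∎
      where
      swap : ∀ i h → (i ℕ.+ i) ℕ.* h ≡ (h ℕ.+ h) ℕ.* i
      swap = NatSolver.solve-∀

    nonqr^h≈-1 : ∀ {a} → a ≉ 0ℤ → ¬ IsQR a (suc m) → a ^ h ≈ -1ℤ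
    nonqr^h≈-1 {a} a≉0 nonresidue with discreteLog a≉0
    ... | i , a≈gⁱ with even⊎odd i
    ...   | inj₁ (j , refl) = ⊥-elim (nonresidue (g ^ j , ≈⇒≡[mod] (begin
      g ^ j * g ^ j  ≡⟨ ^-distribˡ-+-* g j j ⟨
      g ^ (j ℕ.+ j)  ≈⟨ a≈gⁱ ⟨
      a              ∎)))
    ...   | inj₂ (j , refl) = begin
      a ^ h                           ≈⟨ power-of-log (suc (j ℕ.+ j)) h a≈gⁱ ⟩
      g ^ (suc (j ℕ.+ j) ℕ.* h)       ≡⟨ cong (g ^_) (split j h) ⟩
      g ^ (h ℕ.+ (h ℕ.+ h) ℕ.* j)     ≡⟨ ^-distribˡ-+-* g h ((h ℕ.+ h) ℕ.* j) ⟩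
      g ^ h * g ^ ((h ℕ.+ h) ℕ.* j)   ≈⟨ *-cong gʰ≈-1 (g^[[h+h]*i]≈1 j) ⟩
      -1ℤ                             ∎
      where
      split : ∀ j h → suc (j ℕ.+ j) ℕ.* h ≡ h ℕ.+ (h ℕ.+ h) ℕ.* j
      split = NatSolver.solve-∀

    eulerCriterion : ∀ {a v} → a ≉ 0ℤ → Legendre a (suc m) v → a ^ h ≈ v
    eulerCriterion a≉0 (qr square)       = qr^h≈1 a≉0 square
    eulerCriterion a≉0 (nonqr nonsquare) = nonqr^h≈-1 a≉0 nonsquare

module DoubleProduct (k : ℕ) (p-prime : Prime (suc (4 ℕ.* suc k))) {g : ℤ}
                     (g-primitive : IsPrimitiveRoot g (suc (4 ℕ.* suc k))) where

  n : ℕ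
  n = suc k

  open Congruence (suc (4 ℕ.* n))
  open ModPrime p-prime
  open PrimitiveRoot p-prime g-primitive
  open ≈-Reasoning

  ζ : ℕ → ℤ
  ζ r = g ^ (4 ℕ.* r)

  others : ℕ → List ℕ
  others r = filter (λ s → ¬? (r ℕ.≟ s)) (oneTo n)

  ∏ : (ℕ → ℤ) → ℤ
  ∏ f = productℤ (map f (oneTo n))

  ∏-const : ∀ c → ∏ (λ _ → c) ≡ c ^ n
  ∏-const c = trans (productℤ-map-const c (oneTo n)) (cong (c ^_) (length-oneTo n))

  ζ-root : ∀ r → ζ r ^ n ≈ 1ℤ
  ζ-root r = begin
    ζ r ^ n               ≡⟨ ^-*-assoc g (4 ℕ.* r) n ⟩
    g ^ (4 ℕ.* r ℕ.* n)   ≡⟨ cong (g ^_) (swap r n) ⟩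
    g ^ (4 ℕ.* n ℕ.* r)   ≈⟨ g^[m*i]≈1 r ⟩
    1ℤ                    ∎
    where
    swap : ∀ r n → 4 ℕ.* r ℕ.* n ≡ 4 ℕ.* n ℕ.* r
    swap = NatSolver.solve-∀

  ζ-distinct : ∀ {i j} → i < j → j < n → ζ (suc i) ≉ ζ (suc j)
  ζ-distinct i<j j<n =
    gⁱ≉gʲ (ℕ.*-monoʳ-< 4 (s≤s i<j)) (ℕ.≤-<-trans (ℕ.*-monoʳ-≤ 4 j<n) (ℕ.m<n+m (4 ℕ.* n) (s≤s z≤n)))

  ζ-injective : ∀ {r s} → r ∈ oneTo n → s ∈ oneTo n → r ≢ s → ζ r ≉ ζ s
  ζ-injective r∈ s∈ r≢s with i , i<n , refl ← ∈-oneTo⁻ r∈ | j , j<n , refl ← ∈-oneTo⁻ s∈ | ℕ.<-cmp i j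
  ... | tri< i<j _ _ = ζ-distinct i<j j<n
  ... | tri≈ _ i≡j _ = ⊥-elim (r≢s (cong suc i≡j))
  ... | tri> _ _ j<i = ζ-distinct j<i i<n ∘ ≈-sym

  ζ-allDistinct : AllPairs (λ r s → ζ r ≉ ζ s) (oneTo n)
  ζ-allDistinct = AllPairs.map⁺ (AllPairs.applyUpTo⁺₁ id n ζ-distinct)

  -- The value at ζ r of the derivative n xⁿ⁻¹ of xⁿ − 1.
  derivativeAt : ℕ → ℤ
  derivativeAt r = + n * ζ r ^ k

  product-of-differences : ∀ {r} → r ∈ oneTo n →
                           productℤ (map (λ s → ζ r - ζ s) (others r)) ≈ derivativeAt r
  product-of-differences {r} r∈ = begin
    productℤ (map (λ s → ζ r - ζ s) (others r))        ≡⟨ cong productℤ (map-∘ (others r)) ⟩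
    productℤ (map (λ a → ζ r - a) (map ζ (others r)))  ≈⟨ factorisation ⟨
    eval (geometric (ζ r) n) (ζ r)                      ≡⟨ eval-geometric-at (ζ r) k ⟩
    + n * ζ r ^ k                                       ∎
    where
    degree : length (map ζ (others r)) ≡ k
    degree = trans (length-map ζ (others r))
                   (trans (length-filter-≢ (oneTo-unique n) r∈) (cong ℕ.pred (length-oneTo n)))
    root : ∀ {s} → s ∈ others r → eval (geometric (ζ r) n) (ζ s) ≈ 0ℤ
    root {s} s∈ with s∈oneTo , r≢s ← ∈-filter⁻ (λ s → ¬? (r ℕ.≟ s)) s∈ =
      eval-geometric-root n (ζ-injective s∈oneTo r∈ (r≢s ∘ sym)) (≈-trans (ζ-root s) (≈-sym (ζ-root r)))
    factorisation : eval (geometric (ζ r) n) (ζ r) ≈ productℤ (map (λ a → ζ r - a) (map ζ (others r)))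
    factorisation = monic-factorisation (map ζ (others r)) (geometric (ζ r) n)
                      (subst (λ d → Monic d (geometric (ζ r) n)) (sym degree) (geometric-monic (ζ r) k))
                      (AllPairs.map⁺ (AllPairs.filter⁺ (λ s → ¬? (r ℕ.≟ s)) ζ-allDistinct))
                      (Allₚ.map⁺ (All.tabulate root))
                      (ζ r)

  product-of-negated-roots : ∏ (λ r → 0ℤ - ζ r) ≈ -1ℤ
  product-of-negated-roots = begin
    ∏ (λ r → 0ℤ - ζ r)        ≡⟨ cong productℤ (map-∘ {g = λ a → 0ℤ - a} {f = ζ} (oneTo n)) ⟩
    productℤ (map (λ a → 0ℤ - a) (map ζ (oneTo n)))  ≈⟨ factorisation ⟨
    eval (xⁿ-1 n) 0ℤ                                 ≡⟨⟩
    -1ℤ                                              ∎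
    where
    degree : length (map ζ (oneTo n)) ≡ n
    degree = trans (length-map ζ (oneTo n)) (length-oneTo n)
    root : ∀ r → eval (xⁿ-1 n) (ζ r) ≈ 0ℤ
    root r = begin
      eval (xⁿ-1 n) (ζ r)  ≡⟨ eval-xⁿ-1 k (ζ r) ⟩
      ζ r ^ n - 1ℤ         ≈⟨ +-congʳ -1ℤ (ζ-root r) ⟩
      1ℤ - 1ℤ              ∎
    factorisation : eval (xⁿ-1 n) 0ℤ ≈ productℤ (map (λ a → 0ℤ - a) (map ζ (oneTo n)))
    factorisation = monic-factorisation (map ζ (oneTo n)) (xⁿ-1 n)
                      (subst (λ d → Monic d (xⁿ-1 n)) (sym degree) (xⁿ-1-monic k))
                      (AllPairs.map⁺ ζ-allDistinct)
                      (Allₚ.map⁺ (All.universal root (oneTo n)))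
                      0ℤ

  4n≈-1 : + (4 ℕ.* n) ≈ -1ℤ
  4n≈-1 = mod (divides 1ℤ (trans (cong (+_) (ℕ.+-comm (4 ℕ.* n) 1)) (sym (*-identityˡ _))))

  4ⁿ≈legendre : ∀ {v} → Legendre (+ 2) (suc (4 ℕ.* n)) v → (+ 4) ^ n ≈ v
  4ⁿ≈legendre legendre = begin
    (+ 4) ^ n            ≡⟨ ^-*-assoc (+ 2) 2 n ⟩
    (+ 2) ^ (2 ℕ.* n)  ≈⟨ eulerCriterion (2 ℕ.* n) (ℕ.*-distribʳ-+ n 2 2) 2≉0 legendre ⟩
    _                ∎
    where
    2≉0 : + 2 ≉ 0ℤ
    2≉0 = +a≉0 (s≤s z≤n) (s≤s (ℕ.≤-trans (s≤s (s≤s z≤n)) (ℕ.m≤m*n 4 n)))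

  factor≈1 : ∀ r → (+ 4) * derivativeAt r * (0ℤ - ζ r) ≈ 1ℤ
  factor≈1 r = begin
    (+ 4) * (+ n * ζ r ^ k) * (0ℤ - ζ r)  ≡⟨ regroup (+ 4) (+ n) (ζ r) (ζ r ^ k) ⟩
    - (+ (4 ℕ.* n) * ζ r ^ n)              ≈⟨ -‿cong (*-cong 4n≈-1 (ζ-root r)) ⟩
    1ℤ                                     ∎
    where
    regroup : ∀ a b z w → a * (b * w) * (0ℤ - z) ≡ - (a * b * (z * w))
    regroup = solve-∀

  4ⁿ*∏derivative*∏[-ζ]≈1 : (+ 4) ^ n * ∏ derivativeAt * ∏ (λ r → 0ℤ - ζ r) ≈ 1ℤ
  4ⁿ*∏derivative*∏[-ζ]≈1 = begin
    (+ 4) ^ n * ∏ derivativeAt * ∏ (λ r → 0ℤ - ζ r)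
      ≡⟨ cong (λ e → e * ∏ derivativeAt * ∏ (λ r → 0ℤ - ζ r)) (∏-const (+ 4)) ⟨
    ∏ (λ _ → + 4) * ∏ derivativeAt * ∏ (λ r → 0ℤ - ζ r)
      ≡⟨ cong (_* ∏ (λ r → 0ℤ - ζ r)) (productℤ-map-* (λ _ → + 4) derivativeAt (oneTo n)) ⟨
    ∏ (λ r → (+ 4) * derivativeAt r) * ∏ (λ r → 0ℤ - ζ r)
      ≡⟨ productℤ-map-* (λ r → (+ 4) * derivativeAt r) (λ r → 0ℤ - ζ r) (oneTo n) ⟨
    ∏ (λ r → (+ 4) * derivativeAt r * (0ℤ - ζ r))
      ≈⟨ productℤ-cong (oneTo n) (All.universal factor≈1 (oneTo n)) ⟩
    ∏ (λ _ → 1ℤ)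
      ≡⟨ trans (∏-const 1ℤ) (^-zeroˡ n) ⟩
    1ℤ ∎

  doubleProd≈∏derivative : doubleProd g n ≈ ∏ derivativeAt
  doubleProd≈∏derivative = begin
    doubleProd g n
      ≡⟨ productℤ-concatMap (λ r → map (λ s → ζ r - ζ s) (others r)) (oneTo n) ⟩
    ∏ (λ r → productℤ (map (λ s → ζ r - ζ s) (others r)))
      ≈⟨ productℤ-cong (oneTo n) (All.tabulate product-of-differences) ⟩
    ∏ derivativeAt ∎

  doubleProd≈-legendre : ∀ {v} → Legendre (+ 2) (suc (4 ℕ.* n)) v → doubleProd g n ≈ - v
  doubleProd≈-legendre {v} legendre = begin
    doubleProd g n                    ≈⟨ doubleProd≈∏derivative ⟩
    ∏ derivativeAt                    ≡⟨ *-identityˡ (∏ derivativeAt) ⟨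
    1ℤ * ∏ derivativeAt               ≡⟨ cong (_* ∏ derivativeAt) (Legendre⇒v*v≡1 legendre) ⟨
    v * v * ∏ derivativeAt            ≡⟨ rearrange v (∏ derivativeAt) ⟩
    - v * (v * ∏ derivativeAt * -1ℤ)
      ≈⟨ *-congˡ (- v) (*-cong (*-congʳ (∏ derivativeAt) (4ⁿ≈legendre legendre)) product-of-negated-roots) ⟨
    - v * ((+ 4) ^ n * ∏ derivativeAt * ∏ (λ r → 0ℤ - ζ r))
      ≈⟨ *-congˡ (- v) 4ⁿ*∏derivative*∏[-ζ]≈1 ⟩
    - v * 1ℤ                          ≡⟨ *-identityʳ (- v) ⟩
    - v                               ∎
    where
    rearrange : ∀ v a → v * v * a ≡ - v * (v * a * -1ℤ)
    rearrange = solve-∀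

prime≡1[mod4]⇒≡1+4n : ∀ {p} → Prime p → p % 4 ≡ 1 → ∃ λ k → p ≡ suc (4 ℕ.* suc k)
prime≡1[mod4]⇒≡1+4n {p} p-prime p%4≡1 with p / 4 | m≡m%n+[m/n]*n p 4
... | zero  | p≡p%4 = ⊥-elim (¬prime[1] (subst Prime (trans p≡p%4 (trans (ℕ.+-identityʳ _) p%4≡1)) p-prime))
... | suc k | p≡p%4+q*4 = k , trans p≡p%4+q*4 (cong₂ ℕ._+_ p%4≡1 (ℕ.*-comm (suc k) 4))

theorem2p10 : (p : ℕ) → Prime p → p % 4 ≡ 1 → (g : ℤ) → IsPrimitiveRoot g p →
    (v : ℤ) → Legendre (+ 2) p v →
    doubleProd g ((p ∸ 1) / 4) ≡ - v [mod p ]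
theorem2p10 p p-prime p%4≡1 g g-primitive v legendre with prime≡1[mod4]⇒≡1+4n p-prime p%4≡1
... | k , refl = subst (λ n → doubleProd g n ≡ - v [mod p ]) (sym [4n]/4≡n)
                   (≈⇒≡[mod] (doubleProd≈-legendre legendre))
  where
  open DoubleProduct k p-prime g-primitive
  open Congruence p
  [4n]/4≡n : (4 ℕ.* n) / 4 ≡ n
  [4n]/4≡n = trans (cong (_/ 4) (ℕ.*-comm 4 n)) (m*n/n≡m n 4)
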